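{- Let $a,b,c$ be positive integers and $x,y$ formal variables. For every integer $p\ge0$, \[\begin{pmatrix}F_p(x,y)\\ G_p(y)\end{pmatrix}=T_pT_{p-1}\cdots T_1\begin{pmatrix}0\\1\end{pmatrix},\qquad \begin{pmatrix}F^\star_p(x,y)\\ G^\star_p(y)\end{pmatrix}=U_pU_{p-1}\cdots U_1\begin{pmatrix}0\\1\end{pmatrix},\] where (the empty product being the identity matrix) \[T_q=\begin{pmatrix}1+\frac{x}{q^a}&\frac{1}{q^b}\\0&1+\frac{y}{q^c}\end{pmatrix},\qquad U_q=\Bigl(1-\frac{x}{q^c}\Bigr)^{ -1}\Bigl(1-\frac{y}{q^a}\Bigr)^{ -1}\begin{pmatrix}1-\frac{y}{q^a}&\frac{1}{q^b}\\0&1-\frac{x}{q^c}\end{pmatrix}.\]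
   Context: For an integer $p\ge0$ and positive integers $k_1,\ldots,k_r$, the truncated sums are $\zeta_p(k_1,\ldots,k_r)=\sum_{p\ge p_1>p_2>\cdots>p_r>0}p_1^{ -k_1}\cdots p_r^{ -k_r}$ and $\zeta^\star_p(k_1,\ldots,k_r)=\sum_{p\ge p_1\ge\cdots\ge p_r\ge1}p_1^{ -k_1}\cdots p_r^{ -k_r}$ (empty sums are $0$), and $\zeta_p(\varnothing)=\zeta^\star_p(\varnothing)=1$ for the empty index, even for $p=0$. $\{a\}^m$ is the string $a,\ldots,a$ of length $m$. The generating functions (formal power series in $x,y$ with rational coefficients) are $F_p(x,y)=\sum_{m,n\ge0}\zeta_p(\{a\}^m,b,\{c\}^n)x^my^n$, $G_p(y)=\sum_{n\ge0}\zeta_p(\{c\}^n)y^n$, $F^\star_p(x,y)=\sum_{m,n\ge0}\zeta^\star_p(\{c\}^m,b,\{a\}^n)x^my^n$, $G^\star_p(y)=\sum_{n\ge0}\zeta^\star_p(\{a\}^n)y^n$. The inverses $(1-x/q^c)^{ -1}$ etc. are interpreted as geometric series. -}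

module Defs where

open import Data.Nat as ℕ using (ℕ; zero; suc; _∸_)
open import Data.Integer using (+_)
open import Data.Rational using (ℚ; 0ℚ; 1ℚ; _+_; _*_; -_; _/_)
open import Data.List using (List; []; _∷_; _++_; replicate)
open import Relation.Binary.PropositionalEquality using (_≡_)

infixl 6 _+ₚ_
infixl 7 _*ₚ_
infix 4 _≈ₚ_

-- 1/q as a rational number (only used for q ≥ 1; value at 0 is irrelevant)
inv : ℕ → ℚ
inv zero    = 0ℚ
inv (suc n) = + 1 / suc n

_^ℚ_ : ℚ → ℕ → ℚ
r ^ℚ zero  = 1ℚ
r ^ℚ suc k = r * (r ^ℚ k)

invPow : ℕ → ℕ → ℚ
invPow q k = inv q ^ℚ k

sum1 : ℕ → (ℕ → ℚ) → ℚ
sum1 zero    f = 0ℚ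
sum1 (suc p) f = sum1 p f + f (suc p)

sum0 : ℕ → (ℕ → ℚ) → ℚ
sum0 zero    f = f 0
sum0 (suc n) f = sum0 n f + f (suc n)

-- truncated multiple zeta value  ζ_p(k₁,…,k_r) = Σ_{p ≥ p₁ > … > p_r > 0} Π p_i^{-k_i}
zetaT : ℕ → List ℕ → ℚ
zetaT p []       = 1ℚ
zetaT p (k ∷ ks) = sum1 p (λ q → invPow q k * zetaT (q ∸ 1) ks)

-- truncated multiple zeta-star value  ζ*_p(k₁,…,k_r) = Σ_{p ≥ p₁ ≥ … ≥ p_r ≥ 1} Π p_i^{-k_i}
zetaStarT : ℕ → List ℕ → ℚ
zetaStarT p []       = 1ℚ
zetaStarT p (k ∷ ks) = sum1 p (λ q → invPow q k * zetaStarT q ks)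

-- Formal power series in x, y over ℚ: f m n = coefficient of x^m y^n

PS : Set
PS = ℕ → ℕ → ℚ

0ₚ : PS
0ₚ _ _ = 0ℚ

constₚ : ℚ → PS
constₚ r zero zero = r
constₚ r _    _    = 0ℚ

1ₚ : PS
1ₚ = constₚ 1ℚ

xₚ : ℚ → PS
xₚ r (suc zero) zero = r
xₚ r _          _    = 0ℚ

yₚ : ℚ → PS
yₚ r zero (suc zero) = r
yₚ r _    _          = 0ℚ

_+ₚ_ : PS → PS → PS
(f +ₚ g) m n = f m n + g m n

-ₚ_ : PS → PS
(-ₚ f) m n = - f m n

_*ₚ_ : PS → PS → PS
(f *ₚ g) m n = sum0 m (λ i → sum0 n (λ j → f i j * g (m ∸ i) (n ∸ j)))

-- geometric series (1 - r x)^{-1} = Σ_m r^m x^m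
geomXₚ : ℚ → PS
geomXₚ r m zero    = r ^ℚ m
geomXₚ r m (suc n) = 0ℚ

-- geometric series (1 - r y)^{-1} = Σ_n r^n y^n
geomYₚ : ℚ → PS
geomYₚ r zero    n = r ^ℚ n
geomYₚ r (suc m) n = 0ℚ

record Mat : Set where
  constructor mat
  field
    m11 m12 m21 m22 : PS

record Vec2 : Set where
  constructor vec
  field
    v1 v2 : PS

open Mat public
open Vec2 public

idM : Mat
idM = mat 1ₚ 0ₚ 0ₚ 1ₚ

_·M_ : Mat → Mat → Mat
A ·M B = mat (m11 A *ₚ m11 B +ₚ m12 A *ₚ m21 B) (m11 A *ₚ m12 B +ₚ m12 A *ₚ m22 B)
             (m21 A *ₚ m11 B +ₚ m22 A *ₚ m21 B) (m21 A *ₚ m12 B +ₚ m22 A *ₚ m22 B)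

scaleM : PS → Mat → Mat
scaleM s A = mat (s *ₚ m11 A) (s *ₚ m12 A) (s *ₚ m21 A) (s *ₚ m22 A)

_·V_ : Mat → Vec2 → Vec2
A ·V v = vec (m11 A *ₚ v1 v +ₚ m12 A *ₚ v2 v) (m21 A *ₚ v1 v +ₚ m22 A *ₚ v2 v)

e₂ : Vec2
e₂ = vec 0ₚ 1ₚ

T : ℕ → ℕ → ℕ → ℕ → Mat
T a b c q = mat (1ₚ +ₚ xₚ (invPow q a)) (constₚ (invPow q b))
                0ₚ                     (1ₚ +ₚ yₚ (invPow q c))

U : ℕ → ℕ → ℕ → ℕ → Mat
U a b c q = scaleM (geomXₚ (invPow q c) *ₚ geomYₚ (invPow q a))
                   (mat (1ₚ +ₚ (-ₚ yₚ (invPow q a))) (constₚ (invPow q b))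
                        0ₚ                           (1ₚ +ₚ (-ₚ xₚ (invPow q c))))

prodM : (ℕ → Mat) → ℕ → Mat
prodM M zero    = idM
prodM M (suc p) = M (suc p) ·M prodM M p

Fₚ : ℕ → ℕ → ℕ → ℕ → PS
Fₚ a b c p m n = zetaT p (replicate m a ++ (b ∷ replicate n c))

Gₚ : ℕ → ℕ → PS
Gₚ c p zero    n = zetaT p (replicate n c)
Gₚ c p (suc m) n = 0ℚ

F⋆ₚ : ℕ → ℕ → ℕ → ℕ → PS
F⋆ₚ a b c p m n = zetaStarT p (replicate m c ++ (b ∷ replicate n a))

G⋆ₚ : ℕ → ℕ → PS
G⋆ₚ a p zero    n = zetaStarT p (replicate n a)
G⋆ₚ a p (suc m) n = 0ℚ

_≈ₚ_ : PS → PS → Set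
f ≈ₚ g = ∀ m n → f m n ≡ g m n

-- Every T_q and U_q is upper triangular, hence so is each product M_p ⋯ M_1, and
-- applying a matrix to e₂ = (0,1)ᵀ picks out its last column.  So it suffices to show
-- that the last column (f_p, g_p) of M_p ⋯ M_1 satisfies
--   f_0 = 0,  g_0 = 1,  f_{p+1} = (M_{p+1})₁₁ f_p + (M_{p+1})₁₂ g_p,  g_{p+1} = (M_{p+1})₂₂ g_p,
-- for the generating functions in place of (f_p, g_p) (lemma lastColumn-prodM).
-- For T these recursions are the defining recursion
--   ζ_{p+1}(k, ks) = ζ_p(k, ks) + (p+1)^{-k} ζ_p(ks)
-- read coefficientwise.  For U we first compute its entries: with S = (1-γx)^{-1}(1-αy)^{-1}
-- (γ = q^{-c}, α = q^{-a}) one has S(1-αy) = (1-γx)^{-1} and S(1-γx) = (1-αy)^{-1}.  The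
-- recursions then read G*_{p+1} = (1-αy)^{-1} G*_p and F*_{p+1} = (1-γx)^{-1}(F*_p + s G*_{p+1})
-- (s = q^{-b}); both are the ζ* recursion iterated along a block of equal indices, i.e. the
-- solution of a first-order linear recurrence (lemma linear-recurrence).
module Submission where

open import Defs
open import Data.Nat using (ℕ; _≤_; zero; suc; _∸_; z≤n)
open import Data.Product using (_×_; _,_)
open import Data.Nat.Properties using (≤-refl; m≤n⇒m≤1+n; m∸[m∸n]≡n)
open import Data.Rational using (ℚ; 0ℚ; 1ℚ; _+_; _*_; -_)
open import Data.Rational.Properties
  using (+-identityˡ; +-identityʳ; *-identityˡ; *-identityʳ; *-zeroˡ; *-zeroʳ; +-comm; +-assoc; *-comm; *-distribʳ-+; *-distribˡ-+)
open import Data.Rational.Solver using (module +-*-Solver)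
open import Relation.Binary.PropositionalEquality using (_≡_; refl; sym; trans; cong; cong₂; module ≡-Reasoning)
open ≡-Reasoning
open +-*-Solver using (solve; _:+_; _:*_; :-_; _:=_; con)

-- Finite sums  sum0 n f = f 0 + ⋯ + f n

sum0-congᵇ : ∀ n {f g : ℕ → ℚ} → (∀ i → i ≤ n → f i ≡ g i) → sum0 n f ≡ sum0 n g
sum0-congᵇ zero    f≡g = f≡g 0 z≤n
sum0-congᵇ (suc n) f≡g =
  cong₂ _+_ (sum0-congᵇ n (λ i i≤n → f≡g i (m≤n⇒m≤1+n i≤n))) (f≡g (suc n) ≤-refl)

sum0-cong : ∀ n {f g : ℕ → ℚ} → (∀ i → f i ≡ g i) → sum0 n f ≡ sum0 n g
sum0-cong n f≡g = sum0-congᵇ n (λ i _ → f≡g i)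

sum0-zero : ∀ n {f : ℕ → ℚ} → (∀ i → f i ≡ 0ℚ) → sum0 n f ≡ 0ℚ
sum0-zero zero    f≡0 = f≡0 0
sum0-zero (suc n) f≡0 = trans (cong₂ _+_ (sum0-zero n f≡0) (f≡0 (suc n))) (+-identityʳ 0ℚ)

sum0-shift : ∀ n (f : ℕ → ℚ) → sum0 (suc n) f ≡ f 0 + sum0 n (λ i → f (suc i))
sum0-shift zero    f = refl
sum0-shift (suc n) f = begin
  sum0 (suc n) f + f (suc (suc n))                      ≡⟨ cong (_+ f (suc (suc n))) (sum0-shift n f) ⟩
  (f 0 + sum0 n (λ i → f (suc i))) + f (suc (suc n))    ≡⟨ +-assoc (f 0) _ _ ⟩
  f 0 + (sum0 n (λ i → f (suc i)) + f (suc (suc n)))    ∎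

sum0-head : ∀ n {f : ℕ → ℚ} → (∀ i → f (suc i) ≡ 0ℚ) → sum0 n f ≡ f 0
sum0-head zero    _        = refl
sum0-head (suc n) {f} tail≡0 =
  trans (sum0-shift n f) (trans (cong (f 0 +_) (sum0-zero n tail≡0)) (+-identityʳ (f 0)))

sum0-+ : ∀ n (f g : ℕ → ℚ) → sum0 n (λ i → f i + g i) ≡ sum0 n f + sum0 n g
sum0-+ zero    f g = refl
sum0-+ (suc n) f g = begin
  sum0 n (λ i → f i + g i) + (f (suc n) + g (suc n))
    ≡⟨ cong (_+ (f (suc n) + g (suc n))) (sum0-+ n f g) ⟩
  (sum0 n f + sum0 n g) + (f (suc n) + g (suc n))
    ≡⟨ interchange (sum0 n f) (sum0 n g) (f (suc n)) (g (suc n)) ⟩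
  (sum0 n f + f (suc n)) + (sum0 n g + g (suc n))   ∎
  where
  interchange : ∀ u v w z → (u + v) + (w + z) ≡ (u + w) + (v + z)
  interchange = solve 4 (λ u v w z → (u :+ v) :+ (w :+ z) := (u :+ w) :+ (v :+ z)) refl

*-sum0 : ∀ n r (f : ℕ → ℚ) → r * sum0 n f ≡ sum0 n (λ i → r * f i)
*-sum0 zero    r f = refl
*-sum0 (suc n) r f =
  trans (*-distribˡ-+ r (sum0 n f) (f (suc n))) (cong (_+ r * f (suc n)) (*-sum0 n r f))

sum0-reverse : ∀ n (f : ℕ → ℚ) → sum0 n f ≡ sum0 n (λ i → f (n ∸ i))
sum0-reverse zero    f = refl
sum0-reverse (suc n) f = begin
  sum0 n f + f (suc n)                      ≡⟨ +-comm (sum0 n f) _ ⟩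
  f (suc n) + sum0 n f                      ≡⟨ cong (f (suc n) +_) (sum0-reverse n f) ⟩
  f (suc n) + sum0 n (λ i → f (n ∸ i))      ≡⟨ sym (sum0-shift n (λ i → f (suc n ∸ i))) ⟩
  sum0 (suc n) (λ i → f (suc n ∸ i))        ∎

-- First-order linear recurrences

-- The solution of  u₀ = h₀ + t,  u_{m+1} = h_{m+1} + γ u_m  is
-- u_m = Σ_{i ≤ m} γ^i h_{m-i} + γ^m t.  This is how truncated zeta-star values with a
-- block of equal indices unfold.
linear-recurrence : ∀ γ t (u h : ℕ → ℚ) → u 0 ≡ h 0 + t →
  (∀ m → u (suc m) ≡ h (suc m) + γ * u m) →
  ∀ m → u m ≡ sum0 m (λ i → (γ ^ℚ i) * h (m ∸ i)) + (γ ^ℚ m) * t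
linear-recurrence γ t u h u₀ u-step zero =
  trans u₀ (cong₂ _+_ (sym (*-identityˡ (h 0))) (sym (*-identityˡ t)))
linear-recurrence γ t u h u₀ u-step (suc m) = begin
  u (suc m)
    ≡⟨ u-step m ⟩
  h (suc m) + γ * u m
    ≡⟨ cong (λ v → h (suc m) + γ * v) (linear-recurrence γ t u h u₀ u-step m) ⟩
  h (suc m) + γ * (sum0 m term + (γ ^ℚ m) * t)
    ≡⟨ regroup (h (suc m)) γ (sum0 m term) (γ ^ℚ m) t ⟩
  (1ℚ * h (suc m) + γ * sum0 m term) + (γ ^ℚ suc m) * t
    ≡⟨ cong (λ v → (1ℚ * h (suc m) + v) + (γ ^ℚ suc m) * t)
         (trans (*-sum0 m γ term) (sum0-cong m (λ i → assoc γ (γ ^ℚ i) (h (m ∸ i))))) ⟩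
  (1ℚ * h (suc m) + sum0 m (λ i → (γ ^ℚ suc i) * h (m ∸ i))) + (γ ^ℚ suc m) * t
    ≡⟨ cong (_+ (γ ^ℚ suc m) * t) (sym (sum0-shift m (λ i → (γ ^ℚ i) * h (suc m ∸ i)))) ⟩
  sum0 (suc m) (λ i → (γ ^ℚ i) * h (suc m ∸ i)) + (γ ^ℚ suc m) * t   ∎
  where
  term : ℕ → ℚ
  term i = (γ ^ℚ i) * h (m ∸ i)
  assoc : ∀ x y z → x * (y * z) ≡ (x * y) * z
  assoc = solve 3 (λ x y z → x :* (y :* z) := (x :* y) :* z) refl
  regroup : ∀ x g s e t → x + g * (s + e * t) ≡ (1ℚ * x + g * s) + (g * e) * t
  regroup = solve 5 (λ x g s e t → x :+ g :* (s :+ e :* t) := (con 1ℚ :* x :+ g :* s) :+ (g :* e) :* t) refl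

-- The Cauchy product of power series

-- The product is commutative: reindex the double sum by i ↦ m ∸ i, j ↦ n ∸ j.
*ₚ-comm : ∀ f g → f *ₚ g ≈ₚ g *ₚ f
*ₚ-comm f g m n = begin
  sum0 m (λ i → sum0 n (λ j → f i j * g (m ∸ i) (n ∸ j)))
    ≡⟨ sum0-reverse m _ ⟩
  sum0 m (λ i → sum0 n (λ j → f (m ∸ i) j * g (m ∸ (m ∸ i)) (n ∸ j)))
    ≡⟨ sum0-congᵇ m (λ i i≤m → trans (sum0-reverse n _) (sum0-congᵇ n (λ j j≤n →
         trans (*-comm (f (m ∸ i) (n ∸ j)) _)
               (cong₂ (λ k l → g k l * f (m ∸ i) (n ∸ j)) (m∸[m∸n]≡n i≤m) (m∸[m∸n]≡n j≤n))))) ⟩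
  sum0 m (λ i → sum0 n (λ j → g i j * f (m ∸ i) (n ∸ j)))   ∎

*ₚ-congˡ : ∀ {f f'} g → f ≈ₚ f' → f *ₚ g ≈ₚ f' *ₚ g
*ₚ-congˡ g f≈f' m n = sum0-cong m (λ i → sum0-cong n (λ j → cong (_* g (m ∸ i) (n ∸ j)) (f≈f' i j)))

*ₚ-congʳ : ∀ f {g g'} → g ≈ₚ g' → f *ₚ g ≈ₚ f *ₚ g'
*ₚ-congʳ f g≈g' m n = sum0-cong m (λ i → sum0-cong n (λ j → cong (f i j *_) (g≈g' (m ∸ i) (n ∸ j))))

*ₚ-zeroˡ : ∀ {f} g → f ≈ₚ 0ₚ → f *ₚ g ≈ₚ 0ₚ
*ₚ-zeroˡ g f≈0 m n = sum0-zero m (λ i → sum0-zero n (λ j →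
  trans (cong (_* g (m ∸ i) (n ∸ j)) (f≈0 i j)) (*-zeroˡ (g (m ∸ i) (n ∸ j)))))

*ₚ-zeroʳ : ∀ f {g} → g ≈ₚ 0ₚ → f *ₚ g ≈ₚ 0ₚ
*ₚ-zeroʳ f g≈0 m n = sum0-zero m (λ i → sum0-zero n (λ j →
  trans (cong (f i j *_) (g≈0 (m ∸ i) (n ∸ j))) (*-zeroʳ (f i j))))

*ₚ-distribʳ : ∀ f g h → (f +ₚ g) *ₚ h ≈ₚ f *ₚ h +ₚ g *ₚ h
*ₚ-distribʳ f g h m n = trans
  (sum0-cong m (λ i → trans (sum0-cong n (λ j → *-distribʳ-+ _ (f i j) (g i j))) (sum0-+ n _ _)))
  (sum0-+ m _ _)

OnlyY : PS → Set
OnlyY f = ∀ i j → f (suc i) j ≡ 0ℚ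

OnlyX : PS → Set
OnlyX f = ∀ i j → f i (suc j) ≡ 0ℚ

*ₚ-onlyYˡ : ∀ f g → OnlyY f → ∀ m n → (f *ₚ g) m n ≡ sum0 n (λ j → f 0 j * g m (n ∸ j))
*ₚ-onlyYˡ f g f-y m n = sum0-head m (λ i → sum0-zero n (λ j →
  trans (cong (_* g (m ∸ suc i) (n ∸ j)) (f-y i j)) (*-zeroˡ (g (m ∸ suc i) (n ∸ j)))))

*ₚ-onlyYʳ : ∀ f h → OnlyY h → ∀ m n → (f *ₚ h) m n ≡ sum0 n (λ j → f m j * h 0 (n ∸ j))
*ₚ-onlyYʳ f h h-y m n = begin
  (f *ₚ h) m n
    ≡⟨ sum0-reverse m _ ⟩
  sum0 m (λ i → sum0 n (λ j → f (m ∸ i) j * h (m ∸ (m ∸ i)) (n ∸ j)))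
    ≡⟨ sum0-congᵇ m (λ i i≤m → sum0-cong n (λ j → cong (λ k → f (m ∸ i) j * h k (n ∸ j)) (m∸[m∸n]≡n i≤m))) ⟩
  sum0 m (λ i → sum0 n (λ j → f (m ∸ i) j * h i (n ∸ j)))
    ≡⟨ sum0-head m (λ i → sum0-zero n (λ j → trans (cong (f (m ∸ suc i) j *_) (h-y i (n ∸ j))) (*-zeroʳ (f (m ∸ suc i) j)))) ⟩
  sum0 n (λ j → f m j * h 0 (n ∸ j))   ∎

*ₚ-onlyXˡ : ∀ f g → OnlyX f → ∀ m n → (f *ₚ g) m n ≡ sum0 m (λ i → f i 0 * g (m ∸ i) n)
*ₚ-onlyXˡ f g f-x m n = sum0-cong m (λ i → sum0-head n (λ j →
  trans (cong (_* g (m ∸ i) (n ∸ suc j)) (f-x i j)) (*-zeroˡ (g (m ∸ i) (n ∸ suc j)))))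

constₚ-*ₚ : ∀ r g m n → (constₚ r *ₚ g) m n ≡ r * g m n
constₚ-*ₚ r g m n =
  trans (*ₚ-onlyYˡ (constₚ r) g (λ _ _ → refl) m n) (sum0-head n (λ j → *-zeroˡ (g m (n ∸ suc j))))

*ₚ-identityʳ : ∀ f → f *ₚ 1ₚ ≈ₚ f
*ₚ-identityʳ f m n = trans (*ₚ-comm f 1ₚ m n) (trans (constₚ-*ₚ 1ℚ f m n) (*-identityˡ _))

shiftX : ℚ → PS → PS
shiftX r g zero    n = 0ℚ
shiftX r g (suc m) n = r * g m n

shiftY : ℚ → PS → PS
shiftY r g m zero    = 0ℚ
shiftY r g m (suc n) = r * g m n

xₚ-onlyX : ∀ r → OnlyX (xₚ r)
xₚ-onlyX r zero          j = refl
xₚ-onlyX r (suc zero)    j = refl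
xₚ-onlyX r (suc (suc i)) j = refl

yₚ-onlyY : ∀ r → OnlyY (yₚ r)
yₚ-onlyY r i j = refl

xₚ-*ₚ : ∀ r g → xₚ r *ₚ g ≈ₚ shiftX r g
xₚ-*ₚ r g m n = trans (*ₚ-onlyXˡ (xₚ r) g (xₚ-onlyX r) m n) (coefficient m)
  where
  coefficient : ∀ m → sum0 m (λ i → xₚ r i 0 * g (m ∸ i) n) ≡ shiftX r g m n
  coefficient zero    = *-zeroˡ (g 0 n)
  coefficient (suc m) = begin
    sum0 (suc m) (λ i → xₚ r i 0 * g (suc m ∸ i) n)
      ≡⟨ sum0-shift m (λ i → xₚ r i 0 * g (suc m ∸ i) n) ⟩
    0ℚ * g (suc m) n + sum0 m (λ i → xₚ r (suc i) 0 * g (m ∸ i) n)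
      ≡⟨ cong₂ _+_ (*-zeroˡ (g (suc m) n)) (sum0-head m (λ i → *-zeroˡ (g (m ∸ suc i) n))) ⟩
    0ℚ + r * g m n
      ≡⟨ +-identityˡ (r * g m n) ⟩
    r * g m n   ∎

yₚ-*ₚ : ∀ r g → yₚ r *ₚ g ≈ₚ shiftY r g
yₚ-*ₚ r g m n = trans (*ₚ-onlyYˡ (yₚ r) g (yₚ-onlyY r) m n) (coefficient n)
  where
  coefficient : ∀ n → sum0 n (λ j → yₚ r 0 j * g m (n ∸ j)) ≡ shiftY r g m n
  coefficient zero    = *-zeroˡ (g m 0)
  coefficient (suc n) = begin
    sum0 (suc n) (λ j → yₚ r 0 j * g m (suc n ∸ j))
      ≡⟨ sum0-shift n (λ j → yₚ r 0 j * g m (suc n ∸ j)) ⟩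
    0ℚ * g m (suc n) + sum0 n (λ j → yₚ r 0 (suc j) * g m (n ∸ j))
      ≡⟨ cong₂ _+_ (*-zeroˡ (g m (suc n))) (sum0-head n (λ j → *-zeroˡ (g m (n ∸ suc j)))) ⟩
    0ℚ + r * g m n
      ≡⟨ +-identityˡ (r * g m n) ⟩
    r * g m n   ∎

1+-*ₚ : ∀ h g → (1ₚ +ₚ h) *ₚ g ≈ₚ g +ₚ h *ₚ g
1+-*ₚ h g m n = trans (*ₚ-distribʳ 1ₚ h g m n)
  (cong (_+ (h *ₚ g) m n) (trans (constₚ-*ₚ 1ℚ g m n) (*-identityˡ (g m n))))

-ₚxₚ : ∀ r → -ₚ xₚ r ≈ₚ xₚ (- r)
-ₚxₚ r zero          n       = refl
-ₚxₚ r (suc zero)    zero    = refl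
-ₚxₚ r (suc zero)    (suc n) = refl
-ₚxₚ r (suc (suc m)) n       = refl

-ₚyₚ : ∀ r → -ₚ yₚ r ≈ₚ yₚ (- r)
-ₚyₚ r zero    zero          = refl
-ₚyₚ r zero    (suc zero)    = refl
-ₚyₚ r zero    (suc (suc n)) = refl
-ₚyₚ r (suc m) n             = refl

geomXY : ℚ → ℚ → PS
geomXY γ α = geomXₚ γ *ₚ geomYₚ α

geomXY-coeff : ∀ γ α m n → geomXY γ α m n ≡ (γ ^ℚ m) * (α ^ℚ n)
geomXY-coeff γ α m n =
  trans (*ₚ-onlyYʳ (geomXₚ γ) (geomYₚ α) (λ _ _ → refl) m n)
        (sum0-head n (λ j → *-zeroˡ (geomYₚ α 0 (n ∸ suc j))))

geomXY-cancelY : ∀ γ α → geomXY γ α *ₚ (1ₚ +ₚ (-ₚ yₚ α)) ≈ₚ geomXₚ γ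
geomXY-cancelY γ α m n = begin
  (geomXY γ α *ₚ (1ₚ +ₚ (-ₚ yₚ α))) m n
    ≡⟨ *ₚ-comm (geomXY γ α) (1ₚ +ₚ (-ₚ yₚ α)) m n ⟩
  ((1ₚ +ₚ (-ₚ yₚ α)) *ₚ geomXY γ α) m n
    ≡⟨ 1+-*ₚ (-ₚ yₚ α) (geomXY γ α) m n ⟩
  geomXY γ α m n + ((-ₚ yₚ α) *ₚ geomXY γ α) m n
    ≡⟨ cong (geomXY γ α m n +_) (trans (*ₚ-congˡ (geomXY γ α) (-ₚyₚ α) m n) (yₚ-*ₚ (- α) (geomXY γ α) m n)) ⟩
  geomXY γ α m n + shiftY (- α) (geomXY γ α) m n
    ≡⟨ coefficient n ⟩
  geomXₚ γ m n   ∎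
  where
  coefficient : ∀ n → geomXY γ α m n + shiftY (- α) (geomXY γ α) m n ≡ geomXₚ γ m n
  coefficient zero    = trans (+-identityʳ _) (trans (geomXY-coeff γ α m 0) (*-identityʳ _))
  coefficient (suc n) =
    trans (cong₂ _+_ (geomXY-coeff γ α m (suc n)) (cong ((- α) *_) (geomXY-coeff γ α m n)))
          (cancel (γ ^ℚ m) α (α ^ℚ n))
    where
    cancel : ∀ g a e → g * (a * e) + (- a) * (g * e) ≡ 0ℚ
    cancel = solve 3 (λ g a e → g :* (a :* e) :+ (:- a) :* (g :* e) := con 0ℚ) refl

geomXY-cancelX : ∀ γ α → geomXY γ α *ₚ (1ₚ +ₚ (-ₚ xₚ γ)) ≈ₚ geomYₚ α
geomXY-cancelX γ α m n = begin
  (geomXY γ α *ₚ (1ₚ +ₚ (-ₚ xₚ γ))) m n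
    ≡⟨ *ₚ-comm (geomXY γ α) (1ₚ +ₚ (-ₚ xₚ γ)) m n ⟩
  ((1ₚ +ₚ (-ₚ xₚ γ)) *ₚ geomXY γ α) m n
    ≡⟨ 1+-*ₚ (-ₚ xₚ γ) (geomXY γ α) m n ⟩
  geomXY γ α m n + ((-ₚ xₚ γ) *ₚ geomXY γ α) m n
    ≡⟨ cong (geomXY γ α m n +_) (trans (*ₚ-congˡ (geomXY γ α) (-ₚxₚ γ) m n) (xₚ-*ₚ (- γ) (geomXY γ α) m n)) ⟩
  geomXY γ α m n + shiftX (- γ) (geomXY γ α) m n
    ≡⟨ coefficient m ⟩
  geomYₚ α m n   ∎
  where
  coefficient : ∀ m → geomXY γ α m n + shiftX (- γ) (geomXY γ α) m n ≡ geomYₚ α m n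
  coefficient zero    = trans (+-identityʳ _) (trans (geomXY-coeff γ α 0 n) (*-identityˡ _))
  coefficient (suc m) =
    trans (cong₂ _+_ (geomXY-coeff γ α (suc m) n) (cong ((- γ) *_) (geomXY-coeff γ α m n)))
          (cancel γ (γ ^ℚ m) (α ^ℚ n))
    where
    cancel : ∀ g e a → (g * e) * a + (- g) * (e * a) ≡ 0ℚ
    cancel = solve 3 (λ g e a → (g :* e) :* a :+ (:- g) :* (e :* a) := con 0ℚ) refl

geomXY-scale : ∀ γ α s → geomXY γ α *ₚ constₚ s ≈ₚ (λ m n → s * ((γ ^ℚ m) * (α ^ℚ n)))
geomXY-scale γ α s m n =
  trans (*ₚ-comm (geomXY γ α) (constₚ s) m n)
        (trans (constₚ-*ₚ s (geomXY γ α) m n) (cong (s *_) (geomXY-coeff γ α m n)))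

-- Last columns of products of upper triangular matrices

LastColumn : Mat → PS → PS → Set
LastColumn P f g = (m21 P ≈ₚ 0ₚ) × (m12 P ≈ₚ f) × (m22 P ≈ₚ g)

lastColumn-step : ∀ A {P f g} → m21 A ≈ₚ 0ₚ → LastColumn P f g →
  LastColumn (A ·M P) (m11 A *ₚ f +ₚ m12 A *ₚ g) (m22 A *ₚ g)
lastColumn-step A {P} A₂₁≈0 (P₂₁≈0 , P₁₂≈f , P₂₂≈g) =
  (λ m n → trans (cong₂ _+_ (*ₚ-zeroˡ (m11 P) A₂₁≈0 m n) (*ₚ-zeroʳ (m22 A) P₂₁≈0 m n)) (+-identityʳ 0ℚ)) ,
  (λ m n → cong₂ _+_ (*ₚ-congʳ (m11 A) P₁₂≈f m n) (*ₚ-congʳ (m12 A) P₂₂≈g m n)) ,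
  (λ m n → trans (cong₂ _+_ (*ₚ-zeroˡ (m12 P) A₂₁≈0 m n) (*ₚ-congʳ (m22 A) P₂₂≈g m n)) (+-identityˡ _))

lastColumn-resp : ∀ {P f f' g g'} → f ≈ₚ f' → g ≈ₚ g' → LastColumn P f g → LastColumn P f' g'
lastColumn-resp f≈f' g≈g' (P₂₁≈0 , P₁₂≈f , P₂₂≈g) =
  P₂₁≈0 , (λ m n → trans (P₁₂≈f m n) (f≈f' m n)) , (λ m n → trans (P₂₂≈g m n) (g≈g' m n))

lastColumn-prodM : (M : ℕ → Mat) (f g : ℕ → PS) →
  (∀ q → m21 (M q) ≈ₚ 0ₚ) → 0ₚ ≈ₚ f 0 → 1ₚ ≈ₚ g 0 →
  (∀ p → m11 (M (suc p)) *ₚ f p +ₚ m12 (M (suc p)) *ₚ g p ≈ₚ f (suc p)) →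
  (∀ p → m22 (M (suc p)) *ₚ g p ≈ₚ g (suc p)) →
  ∀ p → LastColumn (prodM M p) (f p) (g p)
lastColumn-prodM M f g upper f₀ g₀ f-step g-step zero = (λ _ _ → refl) , f₀ , g₀
lastColumn-prodM M f g upper f₀ g₀ f-step g-step (suc p) =
  lastColumn-resp {M (suc p) ·M prodM M p} (f-step p) (g-step p)
    (lastColumn-step (M (suc p)) {prodM M p} (upper (suc p)) (lastColumn-prodM M f g upper f₀ g₀ f-step g-step p))

lastColumn-·V-e₂ : ∀ P {f g} → LastColumn P f g → (f ≈ₚ v1 (P ·V e₂)) × (g ≈ₚ v2 (P ·V e₂))
lastColumn-·V-e₂ P (P₂₁≈0 , P₁₂≈f , P₂₂≈g) =
  (λ m n → sym (trans (column (m11 P) (m12 P) m n) (P₁₂≈f m n))) ,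
  (λ m n → sym (trans (column (m21 P) (m22 P) m n) (P₂₂≈g m n)))
  where
  column : ∀ u v m n → (u *ₚ 0ₚ +ₚ v *ₚ 1ₚ) m n ≡ v m n
  column u v m n =
    trans (cong₂ _+_ (*ₚ-zeroʳ u (λ _ _ → refl) m n) (*ₚ-identityʳ v m n)) (+-identityˡ (v m n))

-- Recursions of the generating functions in p

-- At p = 0 every nonempty truncated sum vanishes.
F-initial : ∀ a b c → 0ₚ ≈ₚ Fₚ a b c 0
F-initial a b c zero    n = refl
F-initial a b c (suc m) n = refl

G-initial : ∀ c → 1ₚ ≈ₚ Gₚ c 0
G-initial c zero    zero    = refl
G-initial c zero    (suc n) = refl
G-initial c (suc m) n       = refl

F⋆-initial : ∀ a b c → 0ₚ ≈ₚ F⋆ₚ a b c 0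
F⋆-initial a b c zero    n = refl
F⋆-initial a b c (suc m) n = refl

G⋆-initial : ∀ a → 1ₚ ≈ₚ G⋆ₚ a 0
G⋆-initial a zero    zero    = refl
G⋆-initial a zero    (suc n) = refl
G⋆-initial a (suc m) n       = refl

-- F_{p+1} = (1 + x/q^a) F_p + G_p/q^b  with q = p+1: coefficientwise this is
-- ζ_q(k, ks) = ζ_p(k, ks) + q^{-k} ζ_p(ks) for k = a (m > 0) and k = b (m = 0).
T-F-step : ∀ a b c p → m11 (T a b c (suc p)) *ₚ Fₚ a b c p +ₚ m12 (T a b c (suc p)) *ₚ Gₚ c p
                       ≈ₚ Fₚ a b c (suc p)
T-F-step a b c p m n =
  trans (cong₂ _+_ (trans (1+-*ₚ (xₚ α) F m n) (cong (F m n +_) (xₚ-*ₚ α F m n)))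
                   (constₚ-*ₚ s (Gₚ c p) m n))
        (coefficient m)
  where
  α = invPow (suc p) a
  s = invPow (suc p) b
  F = Fₚ a b c p
  coefficient : ∀ m → (F m n + shiftX α F m n) + s * Gₚ c p m n ≡ Fₚ a b c (suc p) m n
  coefficient zero    = cong (_+ s * Gₚ c p 0 n) (+-identityʳ (F 0 n))
  coefficient (suc m) = trans (cong (F (suc m) n + α * F m n +_) (*-zeroʳ s)) (+-identityʳ _)

T-G-step : ∀ a b c p → m22 (T a b c (suc p)) *ₚ Gₚ c p ≈ₚ Gₚ c (suc p)
T-G-step a b c p m n =
  trans (1+-*ₚ (yₚ γ) G m n) (trans (cong (G m n +_) (yₚ-*ₚ γ G m n)) (coefficient m n))
  where
  γ = invPow (suc p) c
  G = Gₚ c p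
  coefficient : ∀ m n → G m n + shiftY γ G m n ≡ Gₚ c (suc p) m n
  coefficient zero    zero    = +-identityʳ 1ℚ
  coefficient zero    (suc n) = refl
  coefficient (suc m) zero    = +-identityʳ 0ℚ
  coefficient (suc m) (suc n) = trans (+-identityˡ (γ * 0ℚ)) (*-zeroʳ γ)

-- Iterating ζ*_q(a, ks) = ζ*_p(a, ks) + α ζ*_q(ks) (q = p+1, α = q^{-a}) along {a}^n:
-- G*_q = (1 - αy)^{-1} G*_p, i.e.  ζ*_q({a}^n) = Σ_{j ≤ n} α^j ζ*_p({a}^{n-j}).
zetaStar-block : ∀ a p n →
  sum0 n (λ j → (invPow (suc p) a ^ℚ j) * G⋆ₚ a p 0 (n ∸ j)) ≡ G⋆ₚ a (suc p) 0 n
zetaStar-block a p n = sym (begin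
  G⋆ₚ a (suc p) 0 n
    ≡⟨ linear-recurrence α 0ℚ (G⋆ₚ a (suc p) 0) (G⋆ₚ a p 0) (sym (+-identityʳ 1ℚ)) (λ _ → refl) n ⟩
  sum0 n (λ j → (α ^ℚ j) * G⋆ₚ a p 0 (n ∸ j)) + (α ^ℚ n) * 0ℚ
    ≡⟨ cong (sum0 n (λ j → (α ^ℚ j) * G⋆ₚ a p 0 (n ∸ j)) +_) (*-zeroʳ (α ^ℚ n)) ⟩
  sum0 n (λ j → (α ^ℚ j) * G⋆ₚ a p 0 (n ∸ j)) + 0ℚ
    ≡⟨ +-identityʳ _ ⟩
  sum0 n (λ j → (α ^ℚ j) * G⋆ₚ a p 0 (n ∸ j))   ∎)
  where
  α = invPow (suc p) a

-- G*_{p+1} = S (1 - x/q^c) G*_p = (1 - y/q^a)^{-1} G*_p.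
U-G-step : ∀ a b c p → m22 (U a b c (suc p)) *ₚ G⋆ₚ a p ≈ₚ G⋆ₚ a (suc p)
U-G-step a b c p m n =
  trans (*ₚ-congˡ (G⋆ₚ a p) (geomXY-cancelX γ α) m n)
        (trans (*ₚ-onlyYˡ (geomYₚ α) (G⋆ₚ a p) (λ _ _ → refl) m n) (coefficient m))
  where
  α = invPow (suc p) a
  γ = invPow (suc p) c
  coefficient : ∀ m → sum0 n (λ j → (α ^ℚ j) * G⋆ₚ a p m (n ∸ j)) ≡ G⋆ₚ a (suc p) m n
  coefficient zero    = zetaStar-block a p n
  coefficient (suc m) = sum0-zero n (λ j → *-zeroʳ (α ^ℚ j))

-- F*_{p+1} = S (1 - y/q^a) F*_p + S q^{-b} G*_p = (1 - γx)^{-1} (F*_p + s G*_{p+1}): the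
-- recursion ζ*_q(c, ks) = ζ*_p(c, ks) + γ ζ*_q(ks) iterated along {c}^m, ending with
-- ζ*_q(b, {a}^n) = ζ*_p(b, {a}^n) + s ζ*_q({a}^n).
U-F-step : ∀ a b c p → m11 (U a b c (suc p)) *ₚ F⋆ₚ a b c p +ₚ m12 (U a b c (suc p)) *ₚ G⋆ₚ a p
                       ≈ₚ F⋆ₚ a b c (suc p)
U-F-step a b c p m n = begin
  (m11 (U a b c (suc p)) *ₚ F) m n + (m12 (U a b c (suc p)) *ₚ G⋆ₚ a p) m n
    ≡⟨ cong₂ _+_ (trans (*ₚ-congˡ F (geomXY-cancelY γ α) m n) (*ₚ-onlyXˡ (geomXₚ γ) F (λ _ _ → refl) m n))
                 boundary-term ⟩
  sum0 m (λ i → (γ ^ℚ i) * F (m ∸ i) n) + (γ ^ℚ m) * (s * G⋆ₚ a (suc p) 0 n)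
    ≡⟨ sym (linear-recurrence γ (s * G⋆ₚ a (suc p) 0 n) (λ k → F⋆ₚ a b c (suc p) k n) (λ k → F k n)
              refl (λ _ → refl) m) ⟩
  F⋆ₚ a b c (suc p) m n   ∎
  where
  α = invPow (suc p) a
  s = invPow (suc p) b
  γ = invPow (suc p) c
  F = F⋆ₚ a b c p
  G = G⋆ₚ a p 0
  regroup : ∀ s g a z → (s * (g * a)) * z ≡ g * (s * (a * z))
  regroup = solve 4 (λ s g a z → (s :* (g :* a)) :* z := g :* (s :* (a :* z))) refl
  -- (S · s · G*_p)_{m,n} = γ^m s Σ_j α^j ζ*_p({a}^{n-j}) = γ^m s ζ*_q({a}^n)
  boundary-term : (m12 (U a b c (suc p)) *ₚ G⋆ₚ a p) m n ≡ (γ ^ℚ m) * (s * G⋆ₚ a (suc p) 0 n)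
  boundary-term = begin
    (m12 (U a b c (suc p)) *ₚ G⋆ₚ a p) m n
      ≡⟨ *ₚ-congˡ (G⋆ₚ a p) (geomXY-scale γ α s) m n ⟩
    ((λ k l → s * ((γ ^ℚ k) * (α ^ℚ l))) *ₚ G⋆ₚ a p) m n
      ≡⟨ *ₚ-onlyYʳ (λ k l → s * ((γ ^ℚ k) * (α ^ℚ l))) (G⋆ₚ a p) (λ _ _ → refl) m n ⟩
    sum0 n (λ j → (s * ((γ ^ℚ m) * (α ^ℚ j))) * G (n ∸ j))
      ≡⟨ sum0-cong n (λ j → regroup s (γ ^ℚ m) (α ^ℚ j) (G (n ∸ j))) ⟩
    sum0 n (λ j → (γ ^ℚ m) * (s * ((α ^ℚ j) * G (n ∸ j))))
      ≡⟨ sym (trans (cong ((γ ^ℚ m) *_) (*-sum0 n s _)) (*-sum0 n (γ ^ℚ m) _)) ⟩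
    (γ ^ℚ m) * (s * sum0 n (λ j → (α ^ℚ j) * G (n ∸ j)))
      ≡⟨ cong (λ v → (γ ^ℚ m) * (s * v)) (zetaStar-block a p n) ⟩
    (γ ^ℚ m) * (s * G⋆ₚ a (suc p) 0 n)   ∎

lemma2p1 : (a b c : ℕ) → 1 ≤ a → 1 ≤ b → 1 ≤ c → (p : ℕ) →
    ((Fₚ a b c p ≈ₚ v1 (prodM (T a b c) p ·V e₂)) × (Gₚ c p ≈ₚ v2 (prodM (T a b c) p ·V e₂)))
    × ((F⋆ₚ a b c p ≈ₚ v1 (prodM (U a b c) p ·V e₂)) × (G⋆ₚ a p ≈ₚ v2 (prodM (U a b c) p ·V e₂)))
lemma2p1 a b c _ _ _ p =
  lastColumn-·V-e₂ (prodM (T a b c) p) (lastColumn-prodM (T a b c) (Fₚ a b c) (Gₚ c) (λ _ _ _ → refl)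
                                          (F-initial a b c) (G-initial c) (T-F-step a b c) (T-G-step a b c) p) ,
  lastColumn-·V-e₂ (prodM (U a b c) p) (lastColumn-prodM (U a b c) (F⋆ₚ a b c) (G⋆ₚ a) U-upper
                                          (F⋆-initial a b c) (G⋆-initial a) (U-F-step a b c) (U-G-step a b c) p)
  where
  U-upper : ∀ q → m21 (U a b c q) ≈ₚ 0ₚ
  U-upper q = *ₚ-zeroʳ (geomXY (invPow q c) (invPow q a)) (λ _ _ → refl)
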